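{- Let $p,q\ge0$. If the intervals of a graph $G$ are $p$-thin and all metric triangles of $G$ have sides of length at most $q$, then $G$ is $(2q+\frac p2)$-hyperbolic and, hence, $G$ has slimness at most $6q+\frac32p+\frac12$.
   Context: Graphs are finite, simple, unweighted, undirected, connected, with shortest-path distance $d$. The interval is $I(u,v)=\{z: d(u,z)+d(z,v)=d(u,v)\}$; for $0\le k\le d(u,v)$ the slice is $S_k(u,v)=\{x\in I(u,v): d(u,x)=k\}$. The intervals of $G$ are $p$-thin if every slice $S_k(u,v)$ (for all $u,v,k$) has diameter at most $p$. Three vertices $x,y,z$ form a metric triangle if $I(x,y),I(y,z),I(x,z)$ pairwise intersect only in their common endpoints; its sides have lengths $d(x,y),d(y,z),d(z,x)$. $G$ is $\delta$-hyperbolic if for any four vertices the two largest of the sums $d(u,v)+d(w,x)$, $d(u,w)+d(v,x)$, $d(u,x)+d(v,w)$ differ by at most $2\delta$. A geodesic triangle (union of shortest paths $P(u,v),P(v,w),P(w,u)$) is $\varsigma$-slim if every vertex of each side is within distance $\varsigma$ of the union of the other two sides; the slimness is the least $\varsigma$ such that all geodesic triangles are $\varsigma$-slim. -}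

module Defs where

open import Data.Nat using (ℕ; zero; suc; _+_; _*_; _≤_; _⊔_; _⊓_)
open import Data.Fin using (Fin)
open import Data.Product using (Σ; _×_; ∃)
open import Data.Sum using (_⊎_)
open import Relation.Binary.PropositionalEquality using (_≡_)
open import Relation.Nullary using (¬_)

data Walk {n : ℕ} (Adj : Fin n → Fin n → Set) : Fin n → Fin n → ℕ → Set where
  nil  : ∀ {u} → Walk Adj u u 0
  cons : ∀ {u v w k} → Adj u v → Walk Adj v w k → Walk Adj u w (suc k)

data _∈W_ {n : ℕ} {Adj : Fin n → Fin n → Set} (x : Fin n) :
          ∀ {u v k} → Walk Adj u v k → Set where
  here-nil  : ∀ {u} → x ≡ u → x ∈W (nil {u = u})
  here-cons : ∀ {u v w k} {e : Adj u v} {W : Walk Adj v w k} → x ≡ u → x ∈W cons e W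
  there     : ∀ {u v w k} {e : Adj u v} {W : Walk Adj v w k} → x ∈W W → x ∈W cons e W

-- A finite, simple, undirected, connected graph on vertex set Fin n,
-- together with its shortest-path distance d: d u v is the length of some
-- u-v walk and every u-v walk has length ≥ d u v.  (Existence of the
-- walks for all u v is connectivity.)
record Graph (n : ℕ) : Set₁ where
  field
    Adj        : Fin n → Fin n → Set
    Adj-sym    : ∀ {u v} → Adj u v → Adj v u
    Adj-irrefl : ∀ {u} → ¬ Adj u u
    d          : Fin n → Fin n → ℕ
    d-walk     : ∀ u v → Walk Adj u v (d u v)
    d-min      : ∀ {u v k} → Walk Adj u v k → d u v ≤ k

module _ {n : ℕ} (G : Graph n) where
  open Graph G

  InInterval : Fin n → Fin n → Fin n → Set
  InInterval u v z = d u z + d z v ≡ d u v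

  InSlice : Fin n → Fin n → ℕ → Fin n → Set
  InSlice u v k x = InInterval u v x × d u x ≡ k

  ThinIntervals : ℕ → Set
  ThinIntervals p = ∀ u v k x y → InSlice u v k x → InSlice u v k y → d x y ≤ p

  MetricTriangle : Fin n → Fin n → Fin n → Set
  MetricTriangle x y z =
      (∀ w → InInterval x y w → InInterval y z w → w ≡ y)
    × (∀ w → InInterval y z w → InInterval x z w → w ≡ z)
    × (∀ w → InInterval x y w → InInterval x z w → w ≡ x)

  MetricTrianglesBounded : ℕ → Set
  MetricTrianglesBounded q = ∀ x y z → MetricTriangle x y z →
    d x y ≤ q × d y z ≤ q × d z x ≤ q

  max3 : ℕ → ℕ → ℕ → ℕ
  max3 a b c = a ⊔ b ⊔ c

  mid3 : ℕ → ℕ → ℕ → ℕ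
  mid3 a b c = (a ⊓ b) ⊔ (b ⊓ c) ⊔ (a ⊓ c)

  -- G is δ-hyperbolic, with the parameter given as twoδ = 2δ (so that
  -- half-integral δ are representable).
  HyperbolicTwice : ℕ → Set
  HyperbolicTwice twoδ = ∀ u v w x →
    max3 (d u v + d w x) (d u w + d v x) (d u x + d v w)
      ≤ mid3 (d u v + d w x) (d u w + d v x) (d u x + d v w) + twoδ

  Slim : ℕ → Set
  Slim ς = ∀ u v w
    (P : Walk Adj u v (d u v)) (Q : Walk Adj v w (d v w)) (R : Walk Adj w u (d w u)) →
      (∀ x → x ∈W P → ∃ λ y → (y ∈W Q ⊎ y ∈W R) × d x y ≤ ς)
    × (∀ x → x ∈W Q → ∃ λ y → (y ∈W P ⊎ y ∈W R) × d x y ≤ ς)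
    × (∀ x → x ∈W R → ∃ λ y → (y ∈W P ⊎ y ∈W Q) × d x y ≤ ς)

{-# OPTIONS --safe #-}
-- Build a quasi-median of u, v, w greedily: u′ furthest from u in I(u,v) ∩ I(u,w), then v′
-- furthest from v in I(v,u′) ∩ I(v,w), then w′ furthest from w in I(w,u′) ∩ I(w,v′).
-- Maximality makes u′v′w′ a metric triangle, so its sides are at most q and
--   d(u,v) + d(u′,w) ≤ d(u,u′) + d(v,w) + 2q.
-- For a fourth vertex x let u″ be the corresponding vertex for u, v, x, say d(u,u′) ≤ d(u,u″).
-- The vertex z at distance d(u,u′) from u on a geodesic to u″ lies in the same slice of I(u,v)
-- as u′, so d(u′,z) ≤ p and
--   d(u,u′) + d(u′,x) ≤ d(u,x) + p.
-- Adding the two inequalities gives the four-point condition with 2δ = 2q + p, which is even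
-- better than the claimed 4q + p.
--
-- For slimness, the four-point condition puts a vertex x of one side almost into the interval of
-- another side [a,b]: d(x,a) + d(x,b) ≤ d(a,b) + 2δ. The vertex y of [a,b] balancing
-- d(x,a) + d(a,y) against d(x,b) + d(y,b) then has 2 d(x,y) ≤ 6δ + 1, by the four-point
-- condition on x, y, a, b.

module Submission where

open import Defs
open import Data.Nat using (ℕ; zero; suc; _+_; _*_; _≤_; _⊔_; _⊓_; _<?_; _≟_; ⌊_/2⌋; ⌈_/2⌉; z≤n; s≤s)
open import Data.Nat.Properties
open import Data.Nat.Tactic.RingSolver using (solve; solve-∀)
open import Algebra.Properties.CommutativeSemigroup +-commutativeSemigroup using (x∙yz≈xz∙y)
open import Data.Fin using (Fin)
open import Data.List using (List; []; _∷_; filter; allFin)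
open import Data.List.Extrema.Nat using (argmax; argmax-all; f[xs]≤f[argmax])
open import Data.List.Membership.Propositional.Properties using (∈-filter⁺; ∈-allFin)
open import Data.List.Relation.Unary.All using (lookup)
open import Data.List.Relation.Unary.All.Properties using (all-filter)
open import Data.Product using (∃; ∃₂; _×_; _,_; proj₁; proj₂; map₁; map₂)
open import Data.Sum using (_⊎_; inj₁; inj₂; swap)
open import Relation.Nullary using (yes; no)
open import Relation.Unary using (Decidable; _∩_)
open import Relation.Unary.Properties using (_∩?_)
open import Relation.Binary.PropositionalEquality
  using (_≡_; refl; sym; trans; cong; cong₂; subst; subst₂; module ≡-Reasoning)

squeeze : ∀ {a a′ b b′ c} → a ≤ a′ → b ≤ b′ → a′ + b′ ≤ c → c ≤ a + b → a ≡ a′ × a + b ≡ c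
squeeze {a} {a′} {b} {b′} a≤a′ b≤b′ a′+b′≤c c≤a+b =
  ≤-antisym a≤a′ (+-cancelʳ-≤ b a′ a (≤-trans (+-monoʳ-≤ a′ b≤b′) (≤-trans a′+b′≤c c≤a+b))) ,
  ≤-antisym (≤-trans (+-mono-≤ a≤a′ b≤b′) a′+b′≤c) c≤a+b

≤⊔+⇒⊎ : ∀ {a b c t} → a ≤ b ⊔ c + t → a ≤ b + t ⊎ a ≤ c + t
≤⊔+⇒⊎ {a} {b} {c} {t} h with ⊔-sel b c
... | inj₁ b⊔c≡b = inj₁ (subst (λ m → a ≤ m + t) b⊔c≡b h)
... | inj₂ b⊔c≡c = inj₂ (subst (λ m → a ≤ m + t) b⊔c≡c h)

max≤mid+ : ∀ {a b c t} → a ≤ b ⊔ c + t → b ≤ a ⊔ c + t → c ≤ a ⊔ b + t →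
           a ⊔ b ⊔ c ≤ (a ⊓ b) ⊔ (b ⊓ c) ⊔ (a ⊓ c) + t
max≤mid+ {a} {b} {c} {t} ha hb hc =
  ⊔-lub (⊔-lub (via ha ab≤mid ac≤mid) (via hb ba≤mid bc≤mid)) (via hc ca≤mid cb≤mid)
  where
  mid : ℕ
  mid = (a ⊓ b) ⊔ (b ⊓ c) ⊔ (a ⊓ c)
  ab≤mid : a ⊓ b ≤ mid
  ab≤mid = ≤-trans (m≤m⊔n (a ⊓ b) (b ⊓ c)) (m≤m⊔n _ (a ⊓ c))
  bc≤mid : b ⊓ c ≤ mid
  bc≤mid = ≤-trans (m≤n⊔m (a ⊓ b) (b ⊓ c)) (m≤m⊔n _ (a ⊓ c))
  ac≤mid : a ⊓ c ≤ mid
  ac≤mid = m≤n⊔m ((a ⊓ b) ⊔ (b ⊓ c)) (a ⊓ c)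
  ba≤mid : b ⊓ a ≤ mid
  ba≤mid = subst (_≤ mid) (⊓-comm a b) ab≤mid
  ca≤mid : c ⊓ a ≤ mid
  ca≤mid = subst (_≤ mid) (⊓-comm a c) ac≤mid
  cb≤mid : c ⊓ b ≤ mid
  cb≤mid = subst (_≤ mid) (⊓-comm b c) bc≤mid
  ≤⊓+ : ∀ {x y} → x ≤ y + t → x ≤ x ⊓ y + t
  ≤⊓+ {x} {y} h with ⊓-sel x y
  ... | inj₁ x⊓y≡x = subst (λ m → x ≤ m + t) (sym x⊓y≡x) (m≤m+n x t)
  ... | inj₂ x⊓y≡y = subst (λ m → x ≤ m + t) (sym x⊓y≡y) h
  via : ∀ {x y z} → x ≤ y ⊔ z + t → x ⊓ y ≤ mid → x ⊓ z ≤ mid → x ≤ mid + t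
  via {x} {y} {z} h xy≤mid xz≤mid with ≤⊔+⇒⊎ {b = y} {c = z} h
  ... | inj₁ x≤y+t = ≤-trans (≤⊓+ x≤y+t) (+-monoˡ-≤ t xy≤mid)
  ... | inj₂ x≤z+t = ≤-trans (≤⊓+ x≤z+t) (+-monoˡ-≤ t xz≤mid)

balance : ∀ α β D → α ≤ β + D → β ≤ α + D →
          ∃₂ λ s t → s + t ≡ D × α + t ≤ suc (β + s) × β + s ≤ suc (α + t)
balance α β zero α≤β β≤α =
  0 , 0 , refl , m≤n⇒m≤1+n (subst (_≤ β + 0) (sym (+-identityʳ α)) α≤β)
               , m≤n⇒m≤1+n (subst (_≤ α + 0) (sym (+-identityʳ β)) β≤α)
balance α β (suc D) α≤β+1+D β≤α+1+D with β <? α + D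
... | yes β<α+D with balance α (suc β) D (subst (α ≤_) (+-suc β D) α≤β+1+D) β<α+D
...   | s , t , s+t≡D , h₁ , h₂ =
  suc s , t , cong suc s+t≡D , subst (λ m → α + t ≤ suc m) (sym (+-suc β s)) h₁
        , subst (_≤ suc (α + t)) (sym (+-suc β s)) h₂
balance α β (suc D) α≤β+1+D β≤α+1+D | no β≮α+D =
  0 , suc D , refl
    , subst₂ _≤_ (sym (+-suc α D)) (cong suc (sym (+-identityʳ β))) (s≤s (≮⇒≥ β≮α+D))
    , m≤n⇒m≤1+n (subst (_≤ α + suc D) (sym (+-identityʳ β)) β≤α+1+D)

≤⌊/2⌋ : ∀ {x m} → 2 * x ≤ m → x ≤ ⌊ m /2⌋
≤⌊/2⌋ {x} {m} 2x≤m = subst (_≤ ⌊ m /2⌋) (sym (n≡⌊n+n/2⌋ x))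
  (⌊n/2⌋-mono (subst (_≤ m) (cong (x +_) (+-identityʳ x)) 2x≤m))

2*⌊/2⌋≤ : ∀ m → 2 * ⌊ m /2⌋ ≤ m
2*⌊/2⌋≤ m = begin
  2 * ⌊ m /2⌋          ≡⟨ cong (⌊ m /2⌋ +_) (+-identityʳ ⌊ m /2⌋) ⟩
  ⌊ m /2⌋ + ⌊ m /2⌋    ≤⟨ +-monoʳ-≤ ⌊ m /2⌋ (⌊n/2⌋≤⌈n/2⌉ m) ⟩
  ⌊ m /2⌋ + ⌈ m /2⌉    ≡⟨ ⌊n/2⌋+⌈n/2⌉≡n m ⟩
  m                    ∎
  where open ≤-Reasoning

⊔+⊔≤suc+ : ∀ {a b} → a ≤ suc b → b ≤ suc a → (a ⊔ b) + (a ⊔ b) ≤ suc (a + b)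
⊔+⊔≤suc+ {a} {b} a≤1+b b≤1+a with ⊔-sel a b
... | inj₁ a⊔b≡a = subst (λ m → m + m ≤ suc (a + b)) (sym a⊔b≡a)
                         (subst (a + a ≤_) (+-suc a b) (+-monoʳ-≤ a a≤1+b))
... | inj₂ a⊔b≡b = subst (λ m → m + m ≤ suc (a + b)) (sym a⊔b≡b) (+-monoˡ-≤ b b≤1+a)

detour-cancel : ∀ {a b c e f t} → a + b ≤ c → c + e ≤ a + f + t → b + e ≤ f + t
detour-cancel {a} {b} {c} {e} {f} {t} a+b≤c c+e≤ = +-cancelˡ-≤ a (b + e) (f + t) (begin
  a + (b + e)   ≡⟨ +-assoc a b e ⟨
  a + b + e     ≤⟨ +-monoˡ-≤ e a+b≤c ⟩
  c + e         ≤⟨ c+e≤ ⟩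
  a + f + t     ≡⟨ +-assoc a f t ⟩
  a + (f + t)   ∎)
  where open ≤-Reasoning

argmax-exists : ∀ {m} {P : Fin m → Set} → Decidable P → (f : Fin m → ℕ) → ∀ {z₀} → P z₀ →
                ∃ λ z → P z × (∀ y → P y → f y ≤ f z)
argmax-exists {m} P? f {z₀} Pz₀ =
  argmax f z₀ candidates ,
  argmax-all f Pz₀ (all-filter P? (allFin m)) ,
  λ y Py → lookup (f[xs]≤f[argmax] z₀ candidates) (∈-filter⁺ P? (∈-allFin y) Py)
  where
  candidates : List (Fin m)
  candidates = filter P? (allFin m)

module _ {n : ℕ} (G : Graph n) where
  open Graph G

  private
    variable
      a b c u v w x y z : Fin n
      k : ℕ

  _++_ : ∀ {l} → Walk Adj u v k → Walk Adj v w l → Walk Adj u w (k + l)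
  nil      ++ W = W
  cons e V ++ W = cons e (V ++ W)

  snoc : Walk Adj u v k → Adj v w → Walk Adj u w (suc k)
  snoc nil          e = cons e nil
  snoc (cons e′ W) e = cons e′ (snoc W e)

  reverse : Walk Adj u v k → Walk Adj v u k
  reverse nil        = nil
  reverse (cons e W) = snoc (reverse W) (Adj-sym e)

  start∈W : (W : Walk Adj u v k) → u ∈W W
  start∈W nil        = here-nil refl
  start∈W (cons e W) = here-cons refl

  splitAt : ∀ s t → s + t ≡ k → (W : Walk Adj u v k) →
            ∃ λ z → z ∈W W × Walk Adj u z s × Walk Adj z v t
  splitAt zero    t refl W          = _ , start∈W W , nil , W
  splitAt (suc s) t ()   nil
  splitAt (suc s) t eq   (cons e W) with splitAt s t (suc-injective eq) W
  ... | z , z∈W , A , B = z , there z∈W , cons e A , B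

  ∈W-split : {W : Walk Adj u v k} → x ∈W W →
             ∃₂ λ i j → i + j ≡ k × Walk Adj u x i × Walk Adj x v j
  ∈W-split {W = nil}      (here-nil refl)  = 0 , 0 , refl , nil , nil
  ∈W-split {W = cons e W} (here-cons refl) = 0 , _ , refl , nil , cons e W
  ∈W-split {W = cons e W} (there x∈W) with ∈W-split x∈W
  ... | i , j , refl , A , B = suc i , j , refl , cons e A , B

  length0⇒≡ : Walk Adj u v 0 → u ≡ v
  length0⇒≡ nil = refl

  d-refl : ∀ u → d u u ≡ 0
  d-refl u = n≤0⇒n≡0 (d-min (nil {u = u}))

  d≡0⇒≡ : d u v ≡ 0 → u ≡ v
  d≡0⇒≡ {u} {v} eq = length0⇒≡ (subst (Walk Adj u v) eq (d-walk u v))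

  d-sym : ∀ u v → d u v ≡ d v u
  d-sym u v = ≤-antisym (d-min (reverse (d-walk v u))) (d-min (reverse (d-walk u v)))

  d-tri : ∀ u v w → d u w ≤ d u v + d v w
  d-tri u v w = d-min (d-walk u v ++ d-walk v w)

  ∈W⇒d+d≤length : {W : Walk Adj u v k} → x ∈W W → d u x + d x v ≤ k
  ∈W⇒d+d≤length x∈W with ∈W-split x∈W
  ... | i , j , refl , A , B = +-mono-≤ (d-min A) (d-min B)

  InInterval? : ∀ a b → Decidable (InInterval G a b)
  InInterval? a b z = d a z + d z b ≟ d a b

  InInterval-start : ∀ a b → InInterval G a b a
  InInterval-start a b = cong (_+ d a b) (d-refl a)

  InInterval-sym : InInterval G a b z → InInterval G b a z
  InInterval-sym {a} {b} {z} z∈I = begin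
    d b z + d z a ≡⟨ cong₂ _+_ (d-sym b z) (d-sym z a) ⟩
    d z b + d a z ≡⟨ +-comm (d z b) (d a z) ⟩
    d a z + d z b ≡⟨ z∈I ⟩
    d a b         ≡⟨ d-sym a b ⟩
    d b a         ∎
    where open ≡-Reasoning

  ∈I-concat : InInterval G a c z → InInterval G z c y → InInterval G a y z × InInterval G a c y
  ∈I-concat {a} {c} {z} {y} z∈I[a,c] y∈I[z,c] =
    let dy≡ , y∈I[a,c] = squeeze (d-tri a z y) ≤-refl a→z→y→c≤ (d-tri a y c)
    in sym dy≡ , y∈I[a,c]
    where
    a→z→y→c≤ : d a z + d z y + d y c ≤ d a c
    a→z→y→c≤ = ≤-reflexive (trans (+-assoc (d a z) (d z y) (d y c))
                                  (trans (cong (d a z +_) y∈I[z,c]) z∈I[a,c]))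

  ∈I-shrink : InInterval G a c z → InInterval G a z y → InInterval G a c y
  ∈I-shrink z∈I y∈I = InInterval-sym (proj₂ (∈I-concat (InInterval-sym z∈I) (InInterval-sym y∈I)))

  slice-nonempty : ∀ {k} → k ≤ d a b → ∃ (InSlice G a b k)
  slice-nonempty {a} {b} {k} k≤d with m≤n⇒∃[o]m+o≡n k≤d
  ... | j , k+j≡d with splitAt k j k+j≡d (d-walk a b)
  ...   | z , _ , A , B =
    let dz≡k , z∈I = squeeze (d-min A) (d-min B) (≤-reflexive k+j≡d) (d-tri a z b)
    in z , z∈I , dz≡k

  Furthest : Fin n → (Fin n → Set) → Fin n → Set
  Furthest a S m = S m × (∀ y → S y → d a y ≤ d a m)

  furthest : ∀ a {S : Fin n → Set} → Decidable S → S a → ∃ (Furthest a S)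
  furthest a S? Sa = argmax-exists S? (d a) Sa

  furthest-gate : ∀ {m} → Furthest a (InInterval G a b ∩ InInterval G a c) m →
                  InInterval G m b y → InInterval G m c y → y ≡ m
  furthest-gate {a} {y = y} {m} ((m∈I[a,b] , m∈I[a,c]) , maximal) y∈I[m,b] y∈I[m,c] =
    sym (d≡0⇒≡ (n≤0⇒n≡0 (+-cancelˡ-≤ (d a m) (d m y) 0 a→m→y≤)))
    where
    m∈I[a,y] : InInterval G a y m
    m∈I[a,y] = proj₁ (∈I-concat m∈I[a,b] y∈I[m,b])
    a→m→y≤ : d a m + d m y ≤ d a m + 0
    a→m→y≤ = subst₂ _≤_ (sym m∈I[a,y]) (sym (+-identityʳ (d a m)))
      (maximal y (proj₂ (∈I-concat m∈I[a,b] y∈I[m,b]) , proj₂ (∈I-concat m∈I[a,c] y∈I[m,c])))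

  module QuasiMedian (u v w : Fin n) where

    u′⋆ : ∃ (Furthest u (InInterval G u v ∩ InInterval G u w))
    u′⋆ = furthest u (InInterval? u v ∩? InInterval? u w)
                     (InInterval-start u v , InInterval-start u w)

    u′ : Fin n
    u′ = proj₁ u′⋆

    v′⋆ : ∃ (Furthest v (InInterval G v u′ ∩ InInterval G v w))
    v′⋆ = furthest v (InInterval? v u′ ∩? InInterval? v w)
                     (InInterval-start v u′ , InInterval-start v w)

    v′ : Fin n
    v′ = proj₁ v′⋆

    w′⋆ : ∃ (Furthest w (InInterval G w u′ ∩ InInterval G w v′))
    w′⋆ = furthest w (InInterval? w u′ ∩? InInterval? w v′)
                     (InInterval-start w u′ , InInterval-start w v′)

    w′ : Fin n
    w′ = proj₁ w′⋆

    u′∈I[u,v] : InInterval G u v u′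
    u′∈I[u,v] = proj₁ (proj₁ (proj₂ u′⋆))

    u′∈I[u,w] : InInterval G u w u′
    u′∈I[u,w] = proj₂ (proj₁ (proj₂ u′⋆))

    v′∈I[v,u′] : InInterval G v u′ v′
    v′∈I[v,u′] = proj₁ (proj₁ (proj₂ v′⋆))

    v′∈I[v,w] : InInterval G v w v′
    v′∈I[v,w] = proj₂ (proj₁ (proj₂ v′⋆))

    w′∈I[w,u′] : InInterval G w u′ w′
    w′∈I[w,u′] = proj₁ (proj₁ (proj₂ w′⋆))

    w′∈I[w,v′] : InInterval G w v′ w′
    w′∈I[w,v′] = proj₂ (proj₁ (proj₂ w′⋆))

    metricTriangle : MetricTriangle G u′ v′ w′
    metricTriangle =
      (λ y y∈I[u′,v′] y∈I[v′,w′] → furthest-gate (proj₂ v′⋆)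
         (InInterval-sym y∈I[u′,v′]) (∈I-shrink (InInterval-sym w′∈I[w,v′]) y∈I[v′,w′])) ,
      (λ y y∈I[v′,w′] y∈I[u′,w′] → furthest-gate (proj₂ w′⋆)
         (InInterval-sym y∈I[u′,w′]) (InInterval-sym y∈I[v′,w′])) ,
      (λ y y∈I[u′,v′] y∈I[u′,w′] → furthest-gate (proj₂ u′⋆)
         (∈I-shrink (InInterval-sym v′∈I[v,u′]) y∈I[u′,v′])
         (∈I-shrink (InInterval-sym w′∈I[w,u′]) y∈I[u′,w′]))

    apex-bound : ∀ {q} → MetricTrianglesBounded G q → d u v + d u′ w ≤ d u u′ + d v w + 2 * q
    apex-bound {q} bounded = begin
      d u v + d u′ w                         ≡⟨ cong (_+ d u′ w) u→u′→v′→v ⟩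
      d u u′ + (d u′ v′ + d v′ v) + d u′ w   ≤⟨ +-mono-≤ (+-monoʳ-≤ (d u u′) u′→v≤) u′→w≤ ⟩
      d u u′ + (q + d v′ v) + (q + d w′ w)   ≡⟨ rearrange (d u u′) q (d v′ v) (d w′ w) ⟩
      d u u′ + (d v′ v + d w′ w) + 2 * q     ≤⟨ +-monoˡ-≤ (2 * q) (+-monoʳ-≤ (d u u′) v′→v+w′→w≤) ⟩
      d u u′ + d v w + 2 * q                 ∎
      where
      open ≤-Reasoning
      sides≤q : d u′ v′ ≤ q × d v′ w′ ≤ q × d w′ u′ ≤ q
      sides≤q = bounded u′ v′ w′ metricTriangle
      u′→v≤ : d u′ v′ + d v′ v ≤ q + d v′ v
      u′→v≤ = +-monoˡ-≤ (d v′ v) (proj₁ sides≤q)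
      u→u′→v′→v : d u v ≡ d u u′ + (d u′ v′ + d v′ v)
      u→u′→v′→v = sym (trans (cong (d u u′ +_) (InInterval-sym v′∈I[v,u′])) u′∈I[u,v])
      u′→w≤ : d u′ w ≤ q + d w′ w
      u′→w≤ = ≤-trans (d-tri u′ w′ w)
                      (+-monoˡ-≤ (d w′ w) (subst (_≤ q) (d-sym w′ u′) (proj₂ (proj₂ sides≤q))))
      v′→v+w′→w≤ : d v′ v + d w′ w ≤ d v w
      v′→v+w′→w≤ = begin
        d v′ v + d w′ w               ≡⟨ cong (_+ d w′ w) (d-sym v′ v) ⟩
        d v v′ + d w′ w               ≤⟨ +-monoʳ-≤ (d v v′) (m≤n+m (d w′ w) (d v′ w′)) ⟩
        d v v′ + (d v′ w′ + d w′ w)   ≡⟨ cong (d v v′ +_) (InInterval-sym w′∈I[w,v′]) ⟩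
        d v v′ + d v′ w               ≡⟨ v′∈I[v,w] ⟩
        d v w                         ∎
      rearrange : ∀ a q b c → a + (q + b) + (q + c) ≡ a + (b + c) + 2 * q
      rearrange = solve-∀

  Apex : ℕ → Fin n → Fin n → Fin n → Set
  Apex c u v w = ∃ λ u′ → InInterval G u v u′ × InInterval G u w u′
                        × d u v + d u′ w ≤ d u u′ + d v w + c

  quasiMedian-apex : ∀ {q} → MetricTrianglesBounded G q → ∀ u v w → Apex (2 * q) u v w
  quasiMedian-apex bounded u v w = u′ , u′∈I[u,v] , u′∈I[u,w] , apex-bound bounded
    where open QuasiMedian u v w

  thin-shortcut : ∀ {p u v x u₁ u₂} → ThinIntervals G p →
    InInterval G u v u₁ → InInterval G u v u₂ → InInterval G u x u₂ → d u u₁ ≤ d u u₂ →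
    d u u₁ + d u₁ x ≤ d u x + p
  thin-shortcut {p} {u} {v} {x} {u₁} {u₂} thin u₁∈I[u,v] u₂∈I[u,v] u₂∈I[u,x] u₁≤u₂
    with slice-nonempty u₁≤u₂
  ... | z , z∈I[u,u₂] , dz≡ = begin
      d u u₁ + d u₁ x              ≤⟨ +-monoʳ-≤ (d u u₁) (d-tri u₁ z x) ⟩
      d u u₁ + (d u₁ z + d z x)    ≤⟨ +-monoʳ-≤ (d u u₁) (+-monoˡ-≤ (d z x) u₁z≤p) ⟩
      d u u₁ + (p + d z x)         ≡⟨ cong (_+ (p + d z x)) (sym dz≡) ⟩
      d u z + (p + d z x)          ≡⟨ x∙yz≈xz∙y (d u z) p (d z x) ⟩
      d u z + d z x + p            ≡⟨ cong (_+ p) (∈I-shrink u₂∈I[u,x] z∈I[u,u₂]) ⟩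
      d u x + p                    ∎
    where
    open ≤-Reasoning
    u₁z≤p : d u₁ z ≤ p
    u₁z≤p = thin u v (d u u₁) u₁ z (u₁∈I[u,v] , refl) (∈I-shrink u₂∈I[u,v] z∈I[u,u₂] , dz≡)

  FourPoint : ℕ → Set
  FourPoint T = ∀ u v w x → d u v + d w x ≤ (d u w + d v x) ⊔ (d u x + d v w) + T

  FourPoint-mono : ∀ {T T′} → T ≤ T′ → FourPoint T → FourPoint T′
  FourPoint-mono T≤T′ fp u v w x = ≤-trans (fp u v w x) (+-monoʳ-≤ _ T≤T′)

  fourPoint-ordered : ∀ {p c u v w x u₁ u₂} → ThinIntervals G p →
    InInterval G u v u₁ → d u v + d u₁ w ≤ d u u₁ + d v w + c →
    InInterval G u v u₂ → InInterval G u x u₂ → d u u₁ ≤ d u u₂ →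
    d u v + d w x ≤ d u x + d v w + (c + p)
  fourPoint-ordered {p} {c} {u} {v} {w} {x} {u₁} {u₂} thin u₁∈I[u,v] apex u₂∈I[u,v] u₂∈I[u,x] u₁≤u₂ =
    +-cancelˡ-≤ (d u u₁) _ _ (begin
      d u u₁ + (d u v + d w x)                ≤⟨ +-monoʳ-≤ (d u u₁) (+-monoʳ-≤ (d u v) w→x≤) ⟩
      d u u₁ + (d u v + (d u₁ w + d u₁ x))    ≡⟨ rearrange (d u u₁) (d u v) (d u₁ w) (d u₁ x) ⟩
      (d u v + d u₁ w) + (d u u₁ + d u₁ x)    ≤⟨ +-mono-≤ apex shortcut ⟩
      (d u u₁ + d v w + c) + (d u x + p)      ≡⟨ rearrange′ (d u u₁) (d v w) c (d u x) p ⟩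
      d u u₁ + (d u x + d v w + (c + p))      ∎)
    where
    open ≤-Reasoning
    shortcut : d u u₁ + d u₁ x ≤ d u x + p
    shortcut = thin-shortcut thin u₁∈I[u,v] u₂∈I[u,v] u₂∈I[u,x] u₁≤u₂
    w→x≤ : d w x ≤ d u₁ w + d u₁ x
    w→x≤ = subst (λ m → d w x ≤ m + d u₁ x) (d-sym w u₁) (d-tri w u₁ x)
    rearrange : ∀ a b c e → a + (b + (c + e)) ≡ (b + c) + (a + e)
    rearrange = solve-∀
    rearrange′ : ∀ a b c e p → (a + b + c) + (e + p) ≡ a + (e + b + (c + p))
    rearrange′ = solve-∀

  fourPoint-from-apexes : ∀ {p c u v w x} → ThinIntervals G p → Apex c u v w → Apex c u v x →
    d u v + d w x ≤ (d u w + d v x) ⊔ (d u x + d v w) + (c + p)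
  fourPoint-from-apexes {u = u} {v} {w} {x} thin
    (u₁ , u₁∈I[u,v] , u₁∈I[u,w] , apex₁) (u₂ , u₂∈I[u,v] , u₂∈I[u,x] , apex₂)
    with ≤-total (d u u₁) (d u u₂)
  ... | inj₁ u₁≤u₂ = ≤-trans (fourPoint-ordered thin u₁∈I[u,v] apex₁ u₂∈I[u,v] u₂∈I[u,x] u₁≤u₂)
                             (+-monoˡ-≤ _ (m≤n⊔m (d u w + d v x) (d u x + d v w)))
  ... | inj₂ u₂≤u₁ = ≤-trans (subst (λ m → d u v + m ≤ d u w + d v x + _) (d-sym x w)
                               (fourPoint-ordered thin u₂∈I[u,v] apex₂ u₁∈I[u,v] u₁∈I[u,w] u₂≤u₁))
                             (+-monoˡ-≤ _ (m≤m⊔n (d u w + d v x) (d u x + d v w)))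

  thin∧bounded⇒fourPoint : ∀ {p q} → ThinIntervals G p → MetricTrianglesBounded G q →
                           FourPoint (2 * q + p)
  thin∧bounded⇒fourPoint thin bounded u v w x =
    fourPoint-from-apexes thin (quasiMedian-apex bounded u v w) (quasiMedian-apex bounded u v x)

  fourPoint⇒hyperbolic : ∀ {T} → FourPoint T → HyperbolicTwice G T
  fourPoint⇒hyperbolic {T} fp u v w x = max≤mid+ (fp u v w x) uw+vx≤ ux+vw≤
    where
    uw+vx≤ : d u w + d v x ≤ (d u v + d w x) ⊔ (d u x + d v w) + T
    uw+vx≤ = subst (λ m → d u w + d v x ≤ (d u v + d w x) ⊔ (d u x + m) + T)
                   (d-sym w v) (fp u w v x)
    ux+vw≤ : d u x + d v w ≤ (d u v + d w x) ⊔ (d u w + d v x) + T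
    ux+vw≤ = subst₂ (λ m m′ → d u x + d v w ≤ (d u v + m) ⊔ (d u w + m′) + T)
                    (d-sym x w) (d-sym x v) (fp u x v w)

  geodesic-near : ∀ {T a b} → FourPoint T → ∀ x (R : Walk Adj a b (d a b)) →
                  d x a + d x b ≤ d a b + T → ∃ λ y → y ∈W R × 2 * d x y ≤ 3 * T + 1
  geodesic-near {T} {a} {b} fp x R xa+xb≤ab+T
    with balance (d x a) (d x b) (d a b)
                 (subst (λ m → d x a ≤ d x b + m) (d-sym b a) (d-tri x b a)) (d-tri x a b)
  ... | s , t , s+t≡ab , balanced₁ , balanced₂ with splitAt s t s+t≡ab R
  ...   | y , y∈R , A , B = y , y∈R ,
    estimate {α = d x a} {β = d x b} (≤-trans (fp x y a b) (+-monoˡ-≤ T (⊔-mono-≤ xa+yb≤ xb+ya≤)))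
             (⊔+⊔≤suc+ balanced₁ balanced₂) s+t≡ab xa+xb≤ab+T
    where
    xa+yb≤ : d x a + d y b ≤ d x a + t
    xa+yb≤ = +-monoʳ-≤ (d x a) (d-min B)
    xb+ya≤ : d x b + d y a ≤ d x b + s
    xb+ya≤ = +-monoʳ-≤ (d x b) (subst (_≤ s) (d-sym a y) (d-min A))
    estimate : ∀ {X D M T α β s t} → X + D ≤ M + T → M + M ≤ suc (α + t + (β + s)) →
               s + t ≡ D → α + β ≤ D + T → 2 * X ≤ 3 * T + 1
    estimate {X} {D} {M} {T} {α} {β} {s} {t} X+D≤ M+M≤ s+t≡D α+β≤ =
      +-cancelʳ-≤ (D + D) (2 * X) (3 * T + 1) (begin
        2 * X + (D + D)                  ≡⟨ solve (X ∷ D ∷ []) ⟩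
        (X + D) + (X + D)                ≤⟨ +-mono-≤ X+D≤ X+D≤ ⟩
        (M + T) + (M + T)                ≡⟨ solve (M ∷ T ∷ []) ⟩
        (M + M) + 2 * T                  ≤⟨ +-monoˡ-≤ (2 * T) M+M≤ ⟩
        suc (α + t + (β + s)) + 2 * T    ≡⟨ solve (α ∷ β ∷ s ∷ t ∷ T ∷ []) ⟩
        suc (s + t + (α + β)) + 2 * T    ≡⟨ cong (λ m → suc (m + (α + β)) + 2 * T) s+t≡D ⟩
        suc (D + (α + β)) + 2 * T        ≤⟨ +-monoˡ-≤ (2 * T) (s≤s (+-monoʳ-≤ D α+β≤)) ⟩
        suc (D + (D + T)) + 2 * T        ≡⟨ solve (D ∷ T ∷ []) ⟩
        3 * T + 1 + (D + D)              ∎)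
      where open ≤-Reasoning

  side-near : ∀ {T} → FourPoint T →
    (P : Walk Adj u v (d u v)) (Q : Walk Adj v w (d v w)) (R : Walk Adj w u (d w u)) →
    ∀ x → x ∈W P → ∃ λ y → (y ∈W Q ⊎ y ∈W R) × d x y ≤ ⌊ 3 * T + 1 /2⌋
  side-near {u} {v} {w} {T} fp P Q R x x∈P with ≤⊔+⇒⊎ {b = d u x + d v w} (fp u v x w)
  ... | inj₁ uv+xw≤ux+vw+T =
    let y , y∈Q , 2xy≤ = geodesic-near fp x Q (detour-cancel x-on-P uv+xw≤ux+vw+T)
    in y , inj₁ y∈Q , ≤⌊/2⌋ 2xy≤
    where
    x-on-P : d u x + d x v ≤ d u v
    x-on-P = ∈W⇒d+d≤length x∈P
  ... | inj₂ uv+xw≤uw+vx+T =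
    let y , y∈R , 2xy≤ = geodesic-near fp x R xw+xu≤wu+T
    in y , inj₂ y∈R , ≤⌊/2⌋ 2xy≤
    where
    x-on-P : d x v + d u x ≤ d u v
    x-on-P = subst (_≤ d u v) (+-comm (d u x) (d x v)) (∈W⇒d+d≤length x∈P)
    ux+xw≤uw+T : d u x + d x w ≤ d u w + T
    ux+xw≤uw+T = detour-cancel x-on-P
      (subst (λ m → d u v + d x w ≤ m + T)
             (trans (cong (d u w +_) (d-sym v x)) (+-comm (d u w) (d x v))) uv+xw≤uw+vx+T)
    xw+xu≤wu+T : d x w + d x u ≤ d w u + T
    xw+xu≤wu+T = subst₂ (λ m m′ → m ≤ m′ + T)
      (trans (+-comm (d u x) (d x w)) (cong (d x w +_) (d-sym u x))) (d-sym u w) ux+xw≤uw+T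

  fourPoint⇒slim : ∀ {T} → FourPoint T → Slim G ⌊ 3 * T + 1 /2⌋
  fourPoint⇒slim fp u v w P Q R =
    side-near fp P Q R ,
    (λ x x∈Q → map₂ (map₁ swap) (side-near fp Q R P x x∈Q)) ,
    side-near fp R P Q

proposition8 : ∀ {n : ℕ} (G : Graph n) (p q : ℕ) →
    ThinIntervals G p → MetricTrianglesBounded G q →
    HyperbolicTwice G (4 * q + p)
      × ∃ (λ ς → Slim G ς × 2 * ς ≤ 12 * q + 3 * p + 1)
proposition8 G p q thin bounded =
  fourPoint⇒hyperbolic G fourPoint ,
  ⌊ 3 * T + 1 /2⌋ ,
  fourPoint⇒slim G fourPoint ,
  ≤-trans (2*⌊/2⌋≤ (3 * T + 1)) (≤-reflexive 3T+1≡)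
  where
  T : ℕ
  T = 4 * q + p
  3T+1≡ : 3 * T + 1 ≡ 12 * q + 3 * p + 1
  3T+1≡ = expand q p
    where
    expand : ∀ q p → 3 * (4 * q + p) + 1 ≡ 12 * q + 3 * p + 1
    expand = solve-∀
  2q≤4q : 2 * q ≤ 4 * q
  2q≤4q = *-monoˡ-≤ q {2} {4} (s≤s (s≤s z≤n))
  fourPoint : FourPoint G T
  fourPoint = FourPoint-mono G (+-monoˡ-≤ p 2q≤4q) (thin∧bounded⇒fourPoint G thin bounded)
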